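{- Let $G$ be a graph with $n$ vertices and let $x\in V(G)$ have degree $n-1$ (i.e. $x$ is adjacent to all other vertices). Let $H$ be the subgraph of $G$ induced by $V(G)\setminus\{x\}$. Then $G$ is a minimal non-word-representable graph if and only if $H$ is a minimal non-comparability graph and $H$ is semi-transitive.
   Context: All graphs are finite and simple. For a word $w$ and letters $i,j$, let $w_{ij}$ be the subsequence of $w$ consisting of all occurrences of $i$ and $j$; $i$ and $j$ alternate in $w$ if $w_{ij}$ contains no factor $ii$ or $jj$. A graph $G$ is word-representable if there is a word $w$ over $V(G)$ such that for all distinct $i,j\in V(G)$, $\{i,j\}\in E(G)$ if and only if $i$ and $j$ alternate in $w$. A graph is minimal non-word-representable if it is not word-representable but every proper induced subgraph is word-representable. A comparability graph is a graph admitting a transitive orientation (an orientation such that $u\to v$ and $v\to w$ imply $u\to w$); a minimal non-comparability graph is a graph that is not a comparability graph but all of whose proper induced subgraphs are comparability graphs. A graph is semi-transitive if it admits an acyclic orientation such that for every directed path $v_1\to v_2\to\cdots\to v_k$, either there is no edge $v_1\to v_k$, or for all $1\le i<j\le k$ there is an edge $v_i\to v_j$. -}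

module Defs where

open import Data.Nat using (ℕ; zero; suc; _<_)
open import Data.Fin using (Fin; zero; suc; inject₁; fromℕ; punchIn; _≟_)
open import Data.Fin.Properties using (punchIn-injective)
import Data.Fin as F
open import Data.Bool using (Bool; true; false)
open import Data.List using (List; []; _∷_)
open import Data.List.Membership.Propositional using (_∈_)
open import Data.Product using (Σ; _×_; _,_)
open import Data.Sum using (_⊎_)
open import Data.Unit using (⊤)
open import Relation.Nullary using (¬_; yes; no)
open import Relation.Binary.PropositionalEquality using (_≡_; _≢_)
open import Function.Definitions using (Injective)
open import Function.Bundles using (_⇔_)

record Graph (n : ℕ) : Set where
  field
    Adj   : Fin n → Fin n → Bool
    sym   : ∀ u v → Adj u v ≡ Adj v u
    irrefl : ∀ v → Adj v v ≡ false
open Graph public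

Edge : ∀ {n} → Graph n → Fin n → Fin n → Set
Edge G u v = Adj G u v ≡ true

induced : ∀ {m n} → Graph n → (f : Fin m → Fin n) → Graph m
induced G f = record
  { Adj = λ i j → Adj G (f i) (f j)
  ; sym = λ i j → sym G (f i) (f j)
  ; irrefl = λ i → irrefl G (f i) }

deleteVertex : ∀ {m} → Graph (suc m) → Fin (suc m) → Graph m
deleteVertex G x = induced G (punchIn x)

restrict : ∀ {n} → Fin n → Fin n → List (Fin n) → List (Fin n)
restrict i j [] = []
restrict i j (a ∷ w) with a ≟ i | a ≟ j
... | yes _ | _     = a ∷ restrict i j w
... | no _  | yes _ = a ∷ restrict i j w
... | no _  | no _  = restrict i j w

NoSquareFactor : ∀ {n} → List (Fin n) → Set
NoSquareFactor []          = ⊤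
NoSquareFactor (a ∷ [])    = ⊤
NoSquareFactor (a ∷ b ∷ w) = a ≢ b × NoSquareFactor (b ∷ w)

Alternate : ∀ {n} → Fin n → Fin n → List (Fin n) → Set
Alternate i j w = NoSquareFactor (restrict i j w)

WordRepresentable : ∀ {n} → Graph n → Set
WordRepresentable {n} G =
  Σ (List (Fin n)) λ w →
    (∀ v → v ∈ w) ×
    (∀ i j → i ≢ j → (Edge G i j ⇔ Alternate i j w))

-- O u v ≡ true means arc u → v
IsOrientation : ∀ {n} → Graph n → (Fin n → Fin n → Bool) → Set
IsOrientation {n} G O =
  (∀ u v → O u v ≡ true → Edge G u v) ×
  (∀ u v → Edge G u v → O u v ≡ true ⊎ O v u ≡ true) ×
  (∀ u v → O u v ≡ true → ¬ (O v u ≡ true))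

Transitive : ∀ {n} → (Fin n → Fin n → Bool) → Set
Transitive O = ∀ u v w → O u v ≡ true → O v w ≡ true → O u w ≡ true

Comparability : ∀ {n} → Graph n → Set
Comparability {n} G =
  Σ (Fin n → Fin n → Bool) λ O → IsOrientation G O × Transitive O

DirPath : ∀ {n} → (Fin n → Fin n → Bool) → (k : ℕ) → (Fin (suc k) → Fin n) → Set
DirPath O k p = ∀ (i : Fin k) → O (p (inject₁ i)) (p (suc i)) ≡ true

Acyclic : ∀ {n} → (Fin n → Fin n → Bool) → Set
Acyclic {n} O = ∀ k (p : Fin (suc k) → Fin n) →
  DirPath O k p → ¬ (O (p (fromℕ k)) (p zero) ≡ true)

SemiTransitiveCond : ∀ {n} → (Fin n → Fin n → Bool) → Set
SemiTransitiveCond {n} O = ∀ k (p : Fin (suc k) → Fin n) →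
  DirPath O k p →
  ¬ (O (p zero) (p (fromℕ k)) ≡ true) ⊎
  (∀ (i j : Fin (suc k)) → i F.< j → O (p i) (p j) ≡ true)

SemiTransitive : ∀ {n} → Graph n → Set
SemiTransitive {n} G =
  Σ (Fin n → Fin n → Bool) λ O →
    IsOrientation G O × Acyclic O × SemiTransitiveCond O

MinimalNon : (∀ {m} → Graph m → Set) → ∀ {n} → Graph n → Set
MinimalNon P {n} G =
  ¬ P G ×
  (∀ m (f : Fin m → Fin n) → Injective _≡_ _≡_ f → m < n → P (induced G f))

MinimalNonWordRepresentable : ∀ {n} → Graph n → Set
MinimalNonWordRepresentable = MinimalNon WordRepresentable

MinimalNonComparability : ∀ {n} → Graph n → Set
MinimalNonComparability = MinimalNon Comparability

-- A word representing G orients each edge away from the endpoint occurring first, and comparing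
-- the numbers of occurrences in prefixes shows that this orientation is semi-transitive.
-- Conversely, a semi-transitive orientation yields a representing word made of "waves": a
-- topological order followed by three copies of it, each vertex omitted from one copy chosen by
-- reachability.  So G is word-representable iff it is semi-transitive.
-- If x is adjacent to all other vertices, a semi-transitive orientation of G becomes a transitive
-- orientation of H = G − x after reversing the arcs between in- and out-neighbours of x, and a
-- transitive orientation of H extends to G with x as a source; so G is word-representable iff H
-- is a comparability graph.  This applies to every induced subgraph containing x, while those
-- avoiding x are induced subgraphs of H and are word-representable as soon as H is semi-transitive.

module Submission where

open import Defs hiding (sym)
open import Data.Bool as Bool using (Bool; true; false; _∧_; _∨_; not; if_then_else_)
open import Data.Empty using (⊥; ⊥-elim)
open import Data.Fin as Fin using (Fin; zero; suc; _≟_; fromℕ; fromℕ<; toℕ; punchIn; punchOut)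
open import Data.Fin.Properties
  using (toℕ-fromℕ; toℕ-fromℕ<; toℕ-inject₁; toℕ<n; ≤fromℕ; ≤∧≢⇒<;
         pigeonhole; any?; 0≢1+n; suc-injective; punchIn-injective; punchInᵢ≢i; punchIn-punchOut)
open import Data.List using (List; []; _∷_; _++_; take; filter; tabulate; allFin; concatMap; cartesianProduct)
open import Data.List.Properties using (++-assoc; filter-accept; filter-reject; ∷-injectiveˡ)
open import Data.List.Membership.Propositional.Properties using (∈-++⁺ʳ; ∈-allFin; ∈-cartesianProduct⁺)
open import Data.List.Relation.Unary.All as All using (All; []; _∷_)
open import Data.List.Membership.Propositional using (_∈_)
open import Data.List.Relation.Unary.Any using (here; there)
open import Data.Nat as ℕ using (ℕ; zero; suc; _+_; _∸_; _≤_; _<_; z≤n; s≤s)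
import Data.Nat.Properties as ℕ
open import Data.Product using (∃; _×_; _,_; proj₁; proj₂; uncurry)
open import Data.Sum using (_⊎_; inj₁; inj₂; [_,_]′)
import Data.Sum as Sum
open import Data.Unit using (⊤; tt)
import Data.Vec as Vec
open import Data.Vec.Properties using (lookup∘tabulate; lookup⇒[]=; []=⇒lookup)
open import Data.Fin.Subset using (Subset; ∣_∣) renaming (_∈_ to _∈ₛ_)
open import Data.Fin.Subset.Properties using (p⊂q⇒∣p∣<∣q∣; ∣p∣≤n)
open import Function.Bundles using (_⇔_; mk⇔; Equivalence)
open import Function.Definitions using (Injective)
open import Function.Base using (_∘_)
open import Function.Construct.Composition using (_⇔-∘_)
open import Relation.Nullary using (¬_; ¬?; Dec; yes; no; does; contradiction)
open import Relation.Unary using (Decidable)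
open import Relation.Nullary.Decidable using (dec-true; dec-false)
open import Relation.Binary.PropositionalEquality

∧-elimˡ : ∀ {a b} → a ∧ b ≡ true → a ≡ true
∧-elimˡ {true} _ = refl

∧-elimʳ : ∀ {a b} → a ∧ b ≡ true → b ≡ true
∧-elimʳ {true} e = e

∧-intro : ∀ {a b} → a ≡ true → b ≡ true → a ∧ b ≡ true
∧-intro refl refl = refl

true≢false : true ≢ false
true≢false ()

∨-elim : ∀ a {b} → a ∨ b ≡ true → a ≡ true ⊎ b ≡ true
∨-elim true  _ = inj₁ refl
∨-elim false e = inj₂ e

∨-introʳ : ∀ a {b} → b ≡ true → a ∨ b ≡ true
∨-introʳ true  _ = refl
∨-introʳ false e = e

does⇒ : ∀ {A : Set} (d : Dec A) → does d ≡ true → A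
does⇒ (yes a) _ = a

module _ {n : ℕ} where

  occ : Fin n → List (Fin n) → ℕ
  occ u []      = 0
  occ u (a ∷ w) with a ≟ u
  ... | yes _ = suc (occ u w)
  ... | no  _ = occ u w

  occ-here : ∀ {a u} w → a ≡ u → occ u (a ∷ w) ≡ suc (occ u w)
  occ-here {a} {u} w a≡u with a ≟ u
  ... | yes _   = refl
  ... | no  a≢u = ⊥-elim (a≢u a≡u)

  occ-there : ∀ {a u} w → a ≢ u → occ u (a ∷ w) ≡ occ u w
  occ-there {a} {u} w a≢u with a ≟ u
  ... | yes a≡u = ⊥-elim (a≢u a≡u)
  ... | no  _   = refl

  restrict-comm : ∀ (u v : Fin n) w → restrict u v w ≡ restrict v u w
  restrict-comm u v [] = refl
  restrict-comm u v (a ∷ w) with a ≟ u | a ≟ v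
  ... | yes _ | yes _ = cong (a ∷_) (restrict-comm u v w)
  ... | yes _ | no  _ = cong (a ∷_) (restrict-comm u v w)
  ... | no  _ | yes _ = cong (a ∷_) (restrict-comm u v w)
  ... | no  _ | no  _ = restrict-comm u v w

  alternate-comm : ∀ {u v : Fin n} w → Alternate u v w → Alternate v u w
  alternate-comm {u} {v} w = subst NoSquareFactor (restrict-comm u v w)

  restrict-⊆ : ∀ (u v : Fin n) w → All (λ a → a ≡ u ⊎ a ≡ v) (restrict u v w)
  restrict-⊆ u v [] = []
  restrict-⊆ u v (a ∷ w) with a ≟ u | a ≟ v
  ... | yes a≡u | _     = inj₁ a≡u ∷ restrict-⊆ u v w
  ... | no  _   | yes a≡v = inj₂ a≡v ∷ restrict-⊆ u v w
  ... | no  _   | no  _ = restrict-⊆ u v w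


  occ-++ : ∀ (v : Fin n) xs ys → occ v (xs ++ ys) ≡ occ v xs + occ v ys
  occ-++ v []       ys = refl
  occ-++ v (a ∷ xs) ys with a ≟ v
  ... | yes _ = cong suc (occ-++ v xs ys)
  ... | no  _ = occ-++ v xs ys

  occ-filter : ∀ {P : Fin n → Set} (P? : Decidable P) {v} xs → P v → occ v (filter P? xs) ≡ occ v xs
  occ-filter P? []           _  = refl
  occ-filter P? {v} (a ∷ xs) Pv with P? a
  ... | yes _ = occ-∷-cong a (occ-filter P? xs Pv)
    where
    occ-∷-cong : ∀ a {ys zs} → occ v ys ≡ occ v zs → occ v (a ∷ ys) ≡ occ v (a ∷ zs)
    occ-∷-cong a eq with a ≟ v
    ... | yes _ = cong suc eq
    ... | no  _ = eq
  ... | no ¬Pa = trans (occ-filter P? xs Pv) (sym (occ-there {a = a} {u = v} xs λ { refl → ¬Pa Pv }))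

  occ-filter-reject : ∀ {P : Fin n → Set} (P? : Decidable P) {v} xs → ¬ P v → occ v (filter P? xs) ≡ 0
  occ-filter-reject P? []           _   = refl
  occ-filter-reject P? {v} (a ∷ xs) ¬Pv with P? a
  ... | yes Pa = trans (occ-there {a = a} {u = v} _ λ { refl → ¬Pv Pa }) (occ-filter-reject P? xs ¬Pv)
  ... | no  _  = occ-filter-reject P? xs ¬Pv

  occ-tabulate-reject : ∀ {k} (f : Fin k → Fin n) {v} → (∀ i → f i ≢ v) → occ v (tabulate f) ≡ 0
  occ-tabulate-reject {zero}  f f≢v = refl
  occ-tabulate-reject {suc k} f f≢v =
    trans (occ-there _ (f≢v zero)) (occ-tabulate-reject (λ i → f (suc i)) (λ i → f≢v (suc i)))

  occ-tabulate : ∀ {k} (f : Fin k → Fin n) → Injective _≡_ _≡_ f → ∀ i → occ (f i) (tabulate f) ≡ 1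
  occ-tabulate f inj zero    =
    trans (occ-here {a = f zero} _ refl)
      (cong suc (occ-tabulate-reject (λ i → f (suc i)) (λ i e → 0≢1+n (sym (inj e)))))
  occ-tabulate f inj (suc i) =
    trans (occ-there _ (λ e → 0≢1+n (inj e))) (occ-tabulate (λ i → f (suc i)) (λ e → suc-injective (inj e)) i)

  occ-allFin : ∀ (v : Fin n) → occ v (allFin n) ≡ 1
  occ-allFin = occ-tabulate (λ v → v) (λ e → e)

  occ≡1⇒∈ : ∀ {v : Fin n} xs → occ v xs ≡ 1 → v ∈ xs
  occ≡1⇒∈ {v} (a ∷ xs) occ≡1 with a ≟ v
  ... | yes a≡v = here (sym a≡v)
  ... | no  _   = there (occ≡1⇒∈ xs occ≡1)

  restrict-++ : ∀ (u v : Fin n) xs ys → restrict u v (xs ++ ys) ≡ restrict u v xs ++ restrict u v ys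
  restrict-++ u v []       ys = refl
  restrict-++ u v (a ∷ xs) ys with a ≟ u | a ≟ v
  ... | yes _ | _     = cong (a ∷_) (restrict-++ u v xs ys)
  ... | no  _ | yes _ = cong (a ∷_) (restrict-++ u v xs ys)
  ... | no  _ | no  _ = restrict-++ u v xs ys

  restrict-filter : ∀ (u v : Fin n) {P : Fin n → Set} (P? : Decidable P) xs →
    restrict u v (filter P? xs) ≡ filter P? (restrict u v xs)
  restrict-filter u v P? [] = refl
  restrict-filter u v P? (a ∷ xs) with P? a
  ... | yes Pa with a ≟ u | a ≟ v
  ...   | yes _ | _     = trans (cong (a ∷_) (restrict-filter u v P? xs)) (sym (filter-accept P? Pa))
  ...   | no  _ | yes _ = trans (cong (a ∷_) (restrict-filter u v P? xs)) (sym (filter-accept P? Pa))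
  ...   | no  _ | no  _ = restrict-filter u v P? xs
  restrict-filter u v P? (a ∷ xs) | no ¬Pa with a ≟ u | a ≟ v
  ...   | yes _ | _     = trans (restrict-filter u v P? xs) (sym (filter-reject P? ¬Pa))
  ...   | no  _ | yes _ = trans (restrict-filter u v P? xs) (sym (filter-reject P? ¬Pa))
  ...   | no  _ | no  _ = restrict-filter u v P? xs

  restrict-absent : ∀ (u v : Fin n) xs → occ u xs ≡ 0 → occ v xs ≡ 0 → restrict u v xs ≡ []
  restrict-absent u v []       _ _ = refl
  restrict-absent u v (a ∷ xs) ou ov with a ≟ u | a ≟ v
  ... | no _ | no _ = restrict-absent u v xs ou ov

  restrict-single : ∀ (u v : Fin n) xs → occ u xs ≡ 1 → occ v xs ≡ 0 → restrict u v xs ≡ u ∷ []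
  restrict-single u v (a ∷ xs) ou ov with a ≟ u | a ≟ v
  ... | yes a≡u | no _ = cong₂ _∷_ a≡u (restrict-absent u v xs (ℕ.suc-injective ou) ov)
  ... | no  _   | no _ = restrict-single u v xs ou ov

  restrict-pair : ∀ (u v : Fin n) xs → u ≢ v → occ u xs ≡ 1 → occ v xs ≡ 1 →
    restrict u v xs ≡ u ∷ v ∷ [] ⊎ restrict u v xs ≡ v ∷ u ∷ []
  restrict-pair u v (a ∷ xs) u≢v ou ov with a ≟ u | a ≟ v
  ... | yes a≡u | yes a≡v = contradiction (trans (sym a≡u) a≡v) u≢v
  ... | yes a≡u | no  _   = inj₁ (cong₂ _∷_ a≡u
    (trans (restrict-comm u v xs) (restrict-single v u xs ov (ℕ.suc-injective ou))))
  ... | no  _   | yes a≡v = inj₂ (cong₂ _∷_ a≡v (restrict-single u v xs ou (ℕ.suc-injective ov)))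
  ... | no  _   | no  _   = restrict-pair u v xs u≢v ou ov

  noSquareFactor-++ : ∀ xs {a : Fin n} ys →
    NoSquareFactor (xs ++ a ∷ ys) ⇔ (NoSquareFactor (xs ++ a ∷ []) × NoSquareFactor (a ∷ ys))
  noSquareFactor-++ xs ys = mk⇔ (split xs) (uncurry (join xs))
    where
    split : ∀ xs {a} → NoSquareFactor (xs ++ a ∷ ys) → NoSquareFactor (xs ++ a ∷ []) × NoSquareFactor (a ∷ ys)
    split []           nsf              = tt , nsf
    split (x ∷ [])     (x≢a , nsf)      = (x≢a , tt) , nsf
    split (x ∷ y ∷ xs) (x≢y , nsf) with split (y ∷ xs) nsf
    ... | left , right = (x≢y , left) , right
    join : ∀ xs {a} → NoSquareFactor (xs ++ a ∷ []) → NoSquareFactor (a ∷ ys) → NoSquareFactor (xs ++ a ∷ ys)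
    join []           _             right = right
    join (x ∷ [])     (x≢a , _)     right = x≢a , right
    join (x ∷ y ∷ xs) (x≢y , left) right = x≢y , join (y ∷ xs) left right


  restrict-concatMap : ∀ {A : Set} (u v : Fin n) (f : A → List (Fin n)) qs →
    restrict u v (concatMap f qs) ≡ concatMap (λ q → restrict u v (f q)) qs
  restrict-concatMap u v f []       = refl
  restrict-concatMap u v f (q ∷ qs) =
    trans (restrict-++ u v (f q) (concatMap f qs)) (cong (restrict u v (f q) ++_) (restrict-concatMap u v f qs))

  concatMap-cong : ∀ {A : Set} {f g : A → List (Fin n)} → (∀ q → f q ≡ g q) →
    ∀ qs → concatMap f qs ≡ concatMap g qs
  concatMap-cong f≗g []       = refl
  concatMap-cong f≗g (q ∷ qs) = cong₂ _++_ (f≗g q) (concatMap-cong f≗g qs)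

  module _ {A : Set} (a : Fin n) (f : A → List (Fin n)) where

    blocks : List A → List (Fin n)
    blocks = concatMap (λ q → a ∷ f q)

    blocks-++-head : ∀ qs ys → ∃ λ r → blocks qs ++ a ∷ ys ≡ a ∷ r
    blocks-++-head []       ys = ys , refl
    blocks-++-head (q ∷ qs) ys = (f q ++ blocks qs) ++ a ∷ ys , refl

    noSquareFactor-blocks : ∀ qs ys →
      NoSquareFactor (blocks qs ++ a ∷ ys) ⇔
      (All (λ q → NoSquareFactor (a ∷ f q ++ a ∷ [])) qs × NoSquareFactor (a ∷ ys))
    noSquareFactor-blocks []       ys = mk⇔ ([] ,_) proj₂
    noSquareFactor-blocks (q ∷ qs) ys with blocks-++-head qs ys
    ... | r , rest≡ = mk⇔ to from
      where
      reassoc : blocks (q ∷ qs) ++ a ∷ ys ≡ (a ∷ f q) ++ a ∷ r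
      reassoc = trans (++-assoc (a ∷ f q) (blocks qs) (a ∷ ys)) (cong ((a ∷ f q) ++_) rest≡)
      split : NoSquareFactor ((a ∷ f q) ++ a ∷ r) ⇔
              (NoSquareFactor ((a ∷ f q) ++ a ∷ []) × NoSquareFactor (a ∷ r))
      split = noSquareFactor-++ (a ∷ f q) r
      ih : NoSquareFactor (blocks qs ++ a ∷ ys) ⇔
           (All (λ q → NoSquareFactor (a ∷ f q ++ a ∷ [])) qs × NoSquareFactor (a ∷ ys))
      ih = noSquareFactor-blocks qs ys
      to : NoSquareFactor (blocks (q ∷ qs) ++ a ∷ ys) →
           All (λ q → NoSquareFactor (a ∷ f q ++ a ∷ [])) (q ∷ qs) × NoSquareFactor (a ∷ ys)
      to nsf with Equivalence.to split (subst NoSquareFactor reassoc nsf)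
      ... | first , rest with Equivalence.to ih (subst NoSquareFactor (sym rest≡) rest)
      ...   | others , final = (first ∷ others) , final
      from : All (λ q → NoSquareFactor (a ∷ f q ++ a ∷ [])) (q ∷ qs) × NoSquareFactor (a ∷ ys) →
             NoSquareFactor (blocks (q ∷ qs) ++ a ∷ ys)
      from (first ∷ others , final) = subst NoSquareFactor (sym reassoc)
        (Equivalence.from split (first , subst NoSquareFactor rest≡ (Equivalence.from ih (others , final))))

-- Alternation through prefix counts

module _ {n : ℕ} where

  Zigzag : Fin n → Fin n → List (Fin n) → Set
  Zigzag u v []      = ⊤
  Zigzag u v (a ∷ l) = a ≡ u × Zigzag v u l

  zigzag⇒noSquareFactor : ∀ {u v : Fin n} l → u ≢ v → Zigzag u v l → NoSquareFactor l
  zigzag⇒noSquareFactor []          _   _                 = tt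
  zigzag⇒noSquareFactor (_ ∷ [])    _   _                 = tt
  zigzag⇒noSquareFactor (_ ∷ b ∷ l) u≢v (refl , refl , z) =
    u≢v , zigzag⇒noSquareFactor (b ∷ l) (≢-sym u≢v) (refl , z)

  noSquareFactor⇒zigzag : ∀ {u v : Fin n} a l → u ≢ v → a ≡ u →
    All (λ b → b ≡ u ⊎ b ≡ v) (a ∷ l) → NoSquareFactor (a ∷ l) → Zigzag u v (a ∷ l)
  noSquareFactor⇒zigzag a []      _   a≡u _                     _           = a≡u , tt
  noSquareFactor⇒zigzag {u} {v} a (b ∷ l) u≢v a≡u (_ ∷ b∈uv ∷ l⊆uv) (a≢b , nsf) =
    a≡u , noSquareFactor⇒zigzag b l (≢-sym u≢v) b≡v (Sum.swap b∈uv ∷ All.map Sum.swap l⊆uv) nsf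
    where
    b≡v : b ≡ v
    b≡v = [ (λ b≡u → contradiction (trans a≡u (sym b≡u)) a≢b) , (λ b≡v → b≡v) ]′ b∈uv

  Balanced : Fin n → Fin n → List (Fin n) → Set
  Balanced u v p = occ v p ≤ occ u p × occ u p ≤ suc (occ v p)

  Leads : Fin n → Fin n → List (Fin n) → Set
  Leads u v w = ∀ k → Balanced u v (take k w)

  leads-∷ : ∀ {a u v : Fin n} w → a ≡ u → u ≢ v → Leads v u w → Leads u v (a ∷ w)
  leads-∷ w a≡u u≢v L zero = z≤n , z≤n
  leads-∷ w a≡u u≢v L (suc k)
    rewrite occ-here (take k w) a≡u | occ-there (take k w) (λ a≡v → u≢v (trans (sym a≡u) a≡v)) =
    proj₂ (L k) , s≤s (proj₁ (L k))

  leads-∷⁻ : ∀ {a u v : Fin n} w → a ≡ u → u ≢ v → Leads u v (a ∷ w) → Leads v u w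
  leads-∷⁻ w a≡u u≢v L k with L (suc k)
  ... | L₁ rewrite occ-here (take k w) a≡u | occ-there (take k w) (λ a≡v → u≢v (trans (sym a≡u) a≡v)) =
    ℕ.≤-pred (proj₂ L₁) , proj₁ L₁

  leads-skip : ∀ {a u v : Fin n} w → a ≢ u → a ≢ v → Leads u v w ⇔ Leads u v (a ∷ w)
  leads-skip {a} {u} {v} w a≢u a≢v = mk⇔ to from
    where
    to : Leads u v w → Leads u v (a ∷ w)
    to L zero = z≤n , z≤n
    to L (suc k) rewrite occ-there (take k w) a≢u | occ-there (take k w) a≢v = L k
    from : Leads u v (a ∷ w) → Leads u v w
    from L k with L (suc k)
    ... | L₁ rewrite occ-there (take k w) a≢u | occ-there (take k w) a≢v = L₁

  zigzag⇒leads : ∀ {u v : Fin n} w → u ≢ v → Zigzag u v (restrict u v w) → Leads u v w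
  zigzag⇒leads [] _ _ zero    = z≤n , z≤n
  zigzag⇒leads [] _ _ (suc _) = z≤n , z≤n
  zigzag⇒leads {u} {v} (a ∷ w) u≢v z with a ≟ u | a ≟ v
  ... | yes a≡u | _       = leads-∷ w a≡u u≢v
    (zigzag⇒leads w (≢-sym u≢v) (subst (Zigzag v u) (restrict-comm u v w) (proj₂ z)))
  ... | no  a≢u | yes _   = contradiction (proj₁ z) a≢u
  ... | no  a≢u | no  a≢v = Equivalence.to (leads-skip w a≢u a≢v) (zigzag⇒leads w u≢v z)

  leads⇒zigzag : ∀ {u v : Fin n} w → u ≢ v → Leads u v w → Zigzag u v (restrict u v w)
  leads⇒zigzag [] _ _ = tt
  leads⇒zigzag {u} {v} (a ∷ w) u≢v L with a ≟ u | a ≟ v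
  ... | yes a≡u | _       = a≡u , subst (Zigzag v u) (restrict-comm v u w)
    (leads⇒zigzag w (≢-sym u≢v) (leads-∷⁻ w a≡u u≢v L))
  ... | no  a≢u | yes a≡v = contradiction (subst₂ _≤_ (occ-here [] a≡v) (occ-there [] a≢u) (proj₁ (L 1))) λ ()
  ... | no  a≢u | no  a≢v = leads⇒zigzag w u≢v (Equivalence.from (leads-skip w a≢u a≢v) L)

  precedes : Fin n → Fin n → List (Fin n) → Bool
  precedes u v [] = false
  precedes u v (a ∷ w) with a ≟ u | a ≟ v
  ... | yes _ | _     = true
  ... | no  _ | yes _ = false
  ... | no  _ | no  _ = precedes u v w

  precedes⇒restrict : ∀ {u v : Fin n} w → precedes u v w ≡ true → ∃ λ r → restrict u v w ≡ u ∷ r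
  precedes⇒restrict {u} {v} (a ∷ w) p with a ≟ u | a ≟ v
  ... | yes a≡u | _     = restrict u v w , cong (_∷ restrict u v w) a≡u
  ... | no  _   | no  _ = precedes⇒restrict w p

  zigzag⇒precedes : ∀ {u v : Fin n} w → u ∈ w → Zigzag u v (restrict u v w) → precedes u v w ≡ true
  zigzag⇒precedes {u} {v} (a ∷ w) u∈w z with a ≟ u | a ≟ v | u∈w
  ... | yes _   | _     | _          = refl
  ... | no  a≢u | yes _ | _          = contradiction (proj₁ z) a≢u
  ... | no  a≢u | no  _ | here u≡a   = contradiction (sym u≡a) a≢u
  ... | no  _   | no  _ | there u∈w′ = zigzag⇒precedes w u∈w′ z

  precedes-asym : ∀ {u v : Fin n} w → u ≢ v → precedes u v w ≡ true → precedes v u w ≡ false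
  precedes-asym {u} {v} (a ∷ w) u≢v p with a ≟ u | a ≟ v
  ... | yes a≡u | yes a≡v = contradiction (trans (sym a≡u) a≡v) u≢v
  ... | yes _   | no  _   = refl
  ... | no  _   | no  _   = precedes-asym w u≢v p

  precedes-total : ∀ {u v : Fin n} w → u ∈ w → precedes u v w ≡ false → precedes v u w ≡ true
  precedes-total {u} {v} (a ∷ w) u∈w p with a ≟ u | a ≟ v | u∈w
  ... | no  _   | yes _ | _          = refl
  ... | no  a≢u | no  _ | here u≡a   = contradiction (sym u≡a) a≢u
  ... | no  _   | no  _ | there u∈w′ = precedes-total w u∈w′ p

  precedes⇒ahead : ∀ {u v : Fin n} w → u ≢ v → precedes u v w ≡ true →
    ∃ λ k → occ v (take k w) < occ u (take k w)
  precedes⇒ahead {u} {v} (a ∷ w) u≢v p with a ≟ u | a ≟ v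
  ... | yes a≡u | _ = 1 , subst₂ _<_ (sym (occ-there [] (λ a≡v → u≢v (trans (sym a≡u) a≡v))))
                                      (sym (occ-here [] a≡u)) (s≤s z≤n)
  ... | no a≢u | no a≢v with precedes⇒ahead w u≢v p
  ... | k , ahead = suc k , subst₂ _<_ (sym (occ-there (take k w) a≢v)) (sym (occ-there (take k w) a≢u)) ahead

  alternate⇒leads : ∀ {u v : Fin n} w → u ≢ v → Alternate u v w → precedes u v w ≡ true → Leads u v w
  alternate⇒leads {u} {v} w u≢v alt p with precedes⇒restrict w p
  ... | r , eq = zigzag⇒leads w u≢v (subst (Zigzag u v) (sym eq)
    (noSquareFactor⇒zigzag u r u≢v refl (subst (All _) eq (restrict-⊆ u v w)) (subst NoSquareFactor eq alt)))

  leads⇒alternate : ∀ {u v : Fin n} w → u ≢ v → Leads u v w → Alternate u v w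
  leads⇒alternate {u} {v} w u≢v L = zigzag⇒noSquareFactor (restrict u v w) u≢v (leads⇒zigzag w u≢v L)

  leads⇒precedes : ∀ {u v : Fin n} w → u ≢ v → u ∈ w → Leads u v w → precedes u v w ≡ true
  leads⇒precedes w u≢v u∈w L = zigzag⇒precedes w u∈w (leads⇒zigzag w u≢v L)

module Orientation {n : ℕ} {G : Graph n} {O : Fin n → Fin n → Bool} (orientation : IsOrientation G O) where

  arc⇒edge : ∀ u v → O u v ≡ true → Edge G u v
  arc⇒edge = proj₁ orientation

  total : ∀ u v → Edge G u v → O u v ≡ true ⊎ O v u ≡ true
  total = proj₁ (proj₂ orientation)

  asym : ∀ u v → O u v ≡ true → ¬ (O v u ≡ true)
  asym = proj₂ (proj₂ orientation)

module _ {n : ℕ} {O : Fin n → Fin n → Bool} where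

  dirPath-related : (_∼_ : Fin n → Fin n → Set) → (∀ {a b c} → a ∼ b → b ∼ c → a ∼ c) →
    (∀ {a b} → O a b ≡ true → a ∼ b) →
    ∀ k (p : Fin (suc k) → Fin n) → DirPath O k p → ∀ {i j} → i Fin.< j → p i ∼ p j
  dirPath-related _∼_ ∼-trans arc⇒∼ (suc k) p d {zero} {suc zero} _ = arc⇒∼ (d zero)
  dirPath-related _∼_ ∼-trans arc⇒∼ (suc k) p d {zero} {suc (suc j)} _ =
    ∼-trans (arc⇒∼ (d zero))
      (dirPath-related _∼_ ∼-trans arc⇒∼ k (λ i → p (suc i)) (λ i → d (suc i)) {zero} {suc j} (s≤s z≤n))
  dirPath-related _∼_ ∼-trans arc⇒∼ (suc k) p d {suc i} {suc j} (s≤s i<j) =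
    dirPath-related _∼_ ∼-trans arc⇒∼ k (λ i → p (suc i)) (λ i → d (suc i)) i<j

  dirPath-related-≤ : (_∼_ : Fin n → Fin n → Set) → (∀ {a} → a ∼ a) →
    (∀ {a b c} → a ∼ b → b ∼ c → a ∼ c) →
    (∀ {a b} → O a b ≡ true → a ∼ b) →
    ∀ k (p : Fin (suc k) → Fin n) → DirPath O k p → ∀ {i j} → i Fin.≤ j → p i ∼ p j
  dirPath-related-≤ _∼_ ∼-refl ∼-trans arc⇒∼ k p d {i} {j} i≤j with i ≟ j
  ... | yes refl = ∼-refl
  ... | no  i≢j  = dirPath-related _∼_ ∼-trans arc⇒∼ k p d (≤∧≢⇒< i≤j i≢j)

comparability⇒semiTransitive : ∀ {n} {G : Graph n} → Comparability G → SemiTransitive G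
comparability⇒semiTransitive {n} {G} (O , orientation , transitive) = O , orientation , acyclic , semi
  where
  open Orientation {G = G} {O = O} orientation using (asym)
  along : ∀ k (p : Fin (suc k) → Fin n) → DirPath O k p → ∀ {i j} → i Fin.< j → O (p i) (p j) ≡ true
  along = dirPath-related (λ a b → O a b ≡ true) (transitive _ _ _) (λ a→b → a→b)
  acyclic : Acyclic O
  acyclic zero    p _ loop = asym _ _ loop loop
  acyclic (suc k) p d back = asym _ _ (along (suc k) p d {zero} {fromℕ (suc k)} (s≤s z≤n)) back
  semi : SemiTransitiveCond O
  semi k p d = inj₂ λ i j → along k p d

module SemiTransitiveOrientation {n : ℕ} (O : Fin n → Fin n → Bool) (acyclic : Acyclic O)
  (semi : SemiTransitiveCond O) where

  no-3-cycle : ∀ {a b c} → O a b ≡ true → O b c ≡ true → O c a ≡ true → ⊥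
  no-3-cycle {a} {b} {c} ab bc ca = acyclic 2 p path ca
    where
    p : Fin 3 → Fin n
    p zero             = a
    p (suc zero)       = b
    p (suc (suc zero)) = c
    path : DirPath O 2 p
    path zero       = ab
    path (suc zero) = bc

  shortcut⇒chords : ∀ {a b c d} → O a b ≡ true → O b c ≡ true → O c d ≡ true → O a d ≡ true →
    O a c ≡ true × O b d ≡ true
  shortcut⇒chords {a} {b} {c} {d} ab bc cd ad = [ contradiction ad , chords ]′ (semi 3 p path)
    where
    p : Fin 4 → Fin n
    p zero                   = a
    p (suc zero)             = b
    p (suc (suc zero))       = c
    p (suc (suc (suc zero))) = d
    path : DirPath O 3 p
    path zero             = ab
    path (suc zero)       = bc
    path (suc (suc zero)) = cd
    chords : (∀ i j → i Fin.< j → O (p i) (p j) ≡ true) → O a c ≡ true × O b d ≡ true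
    chords closed = closed zero (suc (suc zero)) (s≤s z≤n)
                  , closed (suc zero) (suc (suc (suc zero))) (s≤s (s≤s z≤n))

-- Word-representable graphs are semi-transitive

module WordOrientation {n : ℕ} (G : Graph n) (w : List (Fin n)) (w-covers : ∀ v → v ∈ w)
  (represents : ∀ i j → i ≢ j → (Edge G i j ⇔ Alternate i j w)) where

  O : Fin n → Fin n → Bool
  O u v = Adj G u v ∧ precedes u v w

  edge⇒≢ : ∀ {u v} → Edge G u v → u ≢ v
  edge⇒≢ {u} e refl = true≢false (trans (sym e) (irrefl G u))

  arc⇒leads : ∀ {u v} → O u v ≡ true → Leads u v w
  arc⇒leads {u} {v} a = alternate⇒leads w u≢v (Equivalence.to (represents u v u≢v) uv) (∧-elimʳ a)
    where
    uv : Edge G u v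
    uv = ∧-elimˡ a
    u≢v : u ≢ v
    u≢v = edge⇒≢ uv

  leads⇒arc : ∀ {u v} → u ≢ v → Leads u v w → O u v ≡ true
  leads⇒arc {u} {v} u≢v L =
    ∧-intro (Equivalence.from (represents u v u≢v) (leads⇒alternate w u≢v L))
            (leads⇒precedes w u≢v (w-covers u) L)

  Dominates : Fin n → Fin n → Set
  Dominates a b = ∀ k → occ b (take k w) ≤ occ a (take k w)

  StrictlyDominates : Fin n → Fin n → Set
  StrictlyDominates a b = Dominates a b × ∃ λ k → occ b (take k w) < occ a (take k w)

  dominates-trans : ∀ {a b c} → Dominates a b → Dominates b c → Dominates a c
  dominates-trans ab bc k = ℕ.≤-trans (bc k) (ab k)

  strictlyDominates-trans : ∀ {a b c} → StrictlyDominates a b → StrictlyDominates b c → StrictlyDominates a c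
  strictlyDominates-trans (ab , k , ahead) (bc , _) = dominates-trans ab bc , k , ℕ.≤-<-trans (bc k) ahead

  strictlyDominates⇒≢ : ∀ {a b} → StrictlyDominates a b → a ≢ b
  strictlyDominates⇒≢ (_ , _ , ahead) refl = ℕ.<-irrefl refl ahead

  arc⇒strictlyDominates : ∀ {a b} → O a b ≡ true → StrictlyDominates a b
  arc⇒strictlyDominates a = (λ k → proj₁ (arc⇒leads a k)) , precedes⇒ahead w (edge⇒≢ (∧-elimˡ a)) (∧-elimʳ a)

  orientation : IsOrientation G O
  orientation = (λ _ _ → ∧-elimˡ) , total , asym
    where
    total : ∀ u v → Edge G u v → O u v ≡ true ⊎ O v u ≡ true
    total u v e with precedes u v w in p
    ... | true  = inj₁ (∧-intro e refl)
    ... | false = inj₂ (∧-intro (trans (Graph.sym G v u) e) (precedes-total w (w-covers u) p))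
    asym : ∀ u v → O u v ≡ true → ¬ (O v u ≡ true)
    asym u v uv vu = true≢false (trans (sym (∧-elimʳ vu)) (precedes-asym w (edge⇒≢ (∧-elimˡ uv)) (∧-elimʳ uv)))

  module _ (k : ℕ) (p : Fin (suc k) → Fin n) (d : DirPath O k p) where
    strictlyDominates-along : ∀ {i j} → i Fin.< j → StrictlyDominates (p i) (p j)
    strictlyDominates-along = dirPath-related StrictlyDominates strictlyDominates-trans arc⇒strictlyDominates k p d

    dominates-along : ∀ {i j} → i Fin.≤ j → Dominates (p i) (p j)
    dominates-along = dirPath-related-≤ Dominates (λ _ → ℕ.≤-refl) dominates-trans
      (λ a → proj₁ (arc⇒strictlyDominates a)) k p d

  acyclic : Acyclic O
  acyclic k p d back with precedes⇒ahead w (edge⇒≢ (∧-elimˡ back)) (∧-elimʳ back)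
  ... | m , ahead = ℕ.<-irrefl refl (ℕ.≤-<-trans (dominates-along k p d {zero} {fromℕ k} z≤n m) ahead)

  -- Given a shortcut p₀ → pₖ, on every prefix occ pⱼ ≤ occ pᵢ ≤ occ p₀ ≤ 1 + occ pₖ ≤ 1 + occ pⱼ for i < j.
  semiTransitive : SemiTransitiveCond O
  semiTransitive k p d with O (p zero) (p (fromℕ k)) in shortcut
  ... | false = inj₁ λ ()
  ... | true  = inj₂ λ i j i<j → leads⇒arc (strictlyDominates⇒≢ (strictlyDominates-along k p d i<j)) λ m →
    proj₁ (strictlyDominates-along k p d i<j) m ,
    ℕ.≤-trans (dominates-along k p d {zero} {i} z≤n m)
      (ℕ.≤-trans (proj₂ (arc⇒leads shortcut m)) (s≤s (dominates-along k p d {j} {fromℕ k} (≤fromℕ j) m)))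

wordRepresentable⇒semiTransitive : ∀ {n} {G : Graph n} → WordRepresentable G → SemiTransitive G
wordRepresentable⇒semiTransitive {G = G} (w , w-covers , represents) = O , orientation , acyclic , semiTransitive
  where open WordOrientation G w w-covers represents

-- A universal vertex

reorient : Bool → Bool → Bool → Bool → Bool
reorient true  true  ab _  = ab
reorient false false ab _  = ab
reorient true  false _  ba = ba
reorient false true  _  ba = ba

reorient-sound : ∀ sa sb {ab ba} → reorient sa sb ab ba ≡ true → ab ≡ true ⊎ ba ≡ true
reorient-sound true  true  e = inj₁ e
reorient-sound false false e = inj₁ e
reorient-sound true  false e = inj₂ e
reorient-sound false true  e = inj₂ e

reorient-total : ∀ sa sb {ab ba} → ab ≡ true ⊎ ba ≡ true →
  reorient sa sb ab ba ≡ true ⊎ reorient sb sa ba ab ≡ true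
reorient-total true  true  e = e
reorient-total false false e = e
reorient-total true  false e = Sum.swap e
reorient-total false true  e = Sum.swap e

reorient-asym : ∀ sa sb {ab ba} → (ab ≡ true → ba ≡ true → ⊥) →
  reorient sa sb ab ba ≡ true → reorient sb sa ba ab ≡ true → ⊥
reorient-asym true  true  asym e e′ = asym e e′
reorient-asym false false asym e e′ = asym e e′
reorient-asym true  false asym e e′ = asym e′ e
reorient-asym false true  asym e e′ = asym e′ e

module UniversalVertex {m : ℕ} (G : Graph (suc m)) (x : Fin (suc m))
  (universal : ∀ y → y ≢ x → Edge G x y) where

  H : Graph m
  H = deleteVertex G x

  module _ (O : Fin (suc m) → Fin (suc m) → Bool) (orientation : IsOrientation G O)
           (acyclic : Acyclic O) (semi : SemiTransitiveCond O) where

    open SemiTransitiveOrientation O acyclic semi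
    open Orientation {G = G} {O = O} orientation

    out : ∀ {v} → v ≢ x → O v x ≡ false → O x v ≡ true
    out {v} v≢x vx = [ (λ xv → xv) , (λ vx′ → contradiction (trans (sym vx′) vx) true≢false) ]′
      (total x v (universal v v≢x))

    -- Split the other vertices into A (v → x) and B (x → v).  Acyclicity of the triangles through x makes every
    -- arc between A and B point from A to B; reversing exactly these arcs yields a transitive orientation,
    -- since each case of O′-trans is such a triangle or a chord of a path through x with a shortcut.
    O′ : Fin (suc m) → Fin (suc m) → Bool
    O′ a b = reorient (O a x) (O b x) (O a b) (O b a)

    O′-trans : ∀ {a b c} → a ≢ x → b ≢ x → c ≢ x → O′ a b ≡ true → O′ b c ≡ true → O′ a c ≡ true
    O′-trans {a} {b} {c} a≢x b≢x c≢x ab bc with O a x in ax | O b x in bx | O c x in cx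
    ... | true  | true  | true  = proj₁ (shortcut⇒chords ab bc cx ax)
    ... | false | false | false = proj₂ (shortcut⇒chords (out a≢x ax) ab bc (out c≢x cx))
    ... | false | false | true  = proj₁ (shortcut⇒chords cx (out a≢x ax) ab bc)
    ... | false | true  | true  = proj₂ (shortcut⇒chords bc cx (out a≢x ax) ab)
    ... | true  | false | _     = ⊥-elim (no-3-cycle (out b≢x bx) ab ax)
    ... | _     | true  | false = ⊥-elim (no-3-cycle (out c≢x cx) bc bx)

    comparability : Comparability H
    comparability = OH , (edge , total′ , asym′) , transitive
      where
      OH : Fin m → Fin m → Bool
      OH i j = O′ (punchIn x i) (punchIn x j)
      edge : ∀ i j → OH i j ≡ true → Edge H i j
      edge i j e = [ arc⇒edge _ _ , (λ ji → trans (Graph.sym G _ _) (arc⇒edge _ _ ji)) ]′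
        (reorient-sound (O (punchIn x i) x) (O (punchIn x j) x) e)
      total′ : ∀ i j → Edge H i j → OH i j ≡ true ⊎ OH j i ≡ true
      total′ i j e = reorient-total (O (punchIn x i) x) (O (punchIn x j) x) (total _ _ e)
      asym′ : ∀ i j → OH i j ≡ true → ¬ (OH j i ≡ true)
      asym′ i j = reorient-asym (O (punchIn x i) x) (O (punchIn x j) x) (asym _ _)
      transitive : Transitive OH
      transitive i j k = O′-trans (punchInᵢ≢i x i) (punchInᵢ≢i x j) (punchInᵢ≢i x k)

  semiTransitive⇒comparability : SemiTransitive G → Comparability H
  semiTransitive⇒comparability (O , orientation , acyclic , semi) = comparability O orientation acyclic semi

  edge-punchOut : ∀ {a b} (a≢x : a ≢ x) (b≢x : b ≢ x) →
    Edge G a b ⇔ Edge H (punchOut (≢-sym a≢x)) (punchOut (≢-sym b≢x))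
  edge-punchOut a≢x b≢x = mk⇔
    (subst₂ (λ a b → Edge G a b) (sym (punchIn-punchOut (≢-sym a≢x))) (sym (punchIn-punchOut (≢-sym b≢x))))
    (subst₂ (λ a b → Edge G a b) (punchIn-punchOut (≢-sym a≢x)) (punchIn-punchOut (≢-sym b≢x)))

  cone : (Fin m → Fin m → Bool) → Fin (suc m) → Fin (suc m) → Bool
  cone OH a b with a ≟ x | b ≟ x
  ... | yes _   | yes _   = false
  ... | yes _   | no  _   = true
  ... | no  _   | yes _   = false
  ... | no  a≢x | no  b≢x = OH (punchOut (≢-sym a≢x)) (punchOut (≢-sym b≢x))

  module _ (OH : Fin m → Fin m → Bool) (orientation : IsOrientation H OH) (transitive : Transitive OH) where

    open Orientation {G = H} {O = OH} orientation

    cone-comparability : Comparability G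
    cone-comparability = cone OH , (edge , total′ , asym′) , transitive′
      where
      edge : ∀ a b → cone OH a b ≡ true → Edge G a b
      edge a b e with a ≟ x | b ≟ x
      ... | yes refl | no b≢x = universal b b≢x
      ... | no  a≢x  | no b≢x = Equivalence.from (edge-punchOut a≢x b≢x) (arc⇒edge _ _ e)
      total′ : ∀ a b → Edge G a b → cone OH a b ≡ true ⊎ cone OH b a ≡ true
      total′ a b e with a ≟ x | b ≟ x
      ... | yes refl | yes refl = contradiction (trans (sym e) (irrefl G a)) true≢false
      ... | yes _    | no  _    = inj₁ refl
      ... | no  _    | yes _    = inj₂ refl
      ... | no  a≢x  | no  b≢x  = total _ _ (Equivalence.to (edge-punchOut a≢x b≢x) e)
      asym′ : ∀ a b → cone OH a b ≡ true → ¬ (cone OH b a ≡ true)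
      asym′ a b ab ba with a ≟ x | b ≟ x
      ... | no  _ | no  _ = asym _ _ ab ba
      ... | yes _ | no  _ = contradiction ba λ ()
      transitive′ : Transitive (cone OH)
      transitive′ a b c ab bc with a ≟ x | b ≟ x | c ≟ x
      ... | yes _ | no  _ | no  _ = refl
      ... | _     | no  _ | yes _ = contradiction bc λ ()
      ... | no  _ | no  _ | no  _ = transitive _ _ _ ab bc

  semiTransitive⇔comparability : SemiTransitive G ⇔ Comparability H
  semiTransitive⇔comparability = mk⇔ semiTransitive⇒comparability
    λ { (OH , orientation , transitive) →
        comparability⇒semiTransitive {G = G} (cone-comparability OH orientation transitive) }

module Walks {n : ℕ} (O : Fin n → Fin n → Bool) where

  -- Vertices are indexed by all of ℕ (only 0 … length matter), so that segments and
  -- concatenations are mere index shifts.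
  record Walk (u v : Fin n) : Set where
    constructor walk
    field
      length : ℕ
      vertex : ℕ → Fin n
      start  : vertex 0 ≡ u
      end    : vertex length ≡ v
      steps  : ∀ t → t < length → O (vertex t) (vertex (suc t)) ≡ true
  open Walk public

  ε : ∀ {u} → Walk u u
  ε {u} = walk 0 (λ _ → u) refl refl (λ _ ())

  _◅_ : ∀ {u a v} → O u a ≡ true → Walk a v → Walk u v
  _◅_ {u} ua W = walk (suc (length W)) vertex′ refl (end W) steps′
    where
    vertex′ : ℕ → Fin n
    vertex′ zero    = u
    vertex′ (suc t) = vertex W t
    steps′ : ∀ t → t < suc (length W) → O (vertex′ t) (vertex′ (suc t)) ≡ true
    steps′ zero    _         = subst (λ a → O u a ≡ true) (sym (start W)) ua
    steps′ (suc t) (s≤s t<l) = steps W t t<l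

  splice : ℕ → (ℕ → Fin n) → (ℕ → Fin n) → ℕ → Fin n
  splice l f g t with t ℕ.≤? l
  ... | yes _ = f t
  ... | no  _ = g (t ∸ l)

  splice-≤ : ∀ l f g {t} → t ≤ l → splice l f g t ≡ f t
  splice-≤ l f g {t} t≤l with t ℕ.≤? l
  ... | yes _   = refl
  ... | no  t≰l = contradiction t≤l t≰l

  splice-+ : ∀ l f g → f l ≡ g 0 → ∀ s → splice l f g (l + s) ≡ g s
  splice-+ l f g fl≡g0 s with l + s ℕ.≤? l
  splice-+ l f g fl≡g0 zero    | yes _   = trans (cong f (ℕ.+-identityʳ l)) fl≡g0
  splice-+ l f g fl≡g0 (suc s) | yes l+s≤l = contradiction l+s≤l (ℕ.<⇒≱ (ℕ.m<m+n l (s≤s z≤n)))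
  ... | no  _   = cong g (ℕ.m+n∸m≡n l s)

  infixr 5 _◅◅_
  _◅◅_ : ∀ {u v w} → Walk u v → Walk v w → Walk u w
  _◅◅_ {u} {v} {w} W₁ W₂ = walk (l₁ + length W₂) vertex′ start′ end′ steps′
    where
    l₁ : ℕ
    l₁ = length W₁
    vertex′ : ℕ → Fin n
    vertex′ = splice l₁ (vertex W₁) (vertex W₂)
    before : ∀ {t} → t ≤ l₁ → vertex′ t ≡ vertex W₁ t
    before = splice-≤ l₁ (vertex W₁) (vertex W₂)
    after : ∀ s → vertex′ (l₁ + s) ≡ vertex W₂ s
    after = splice-+ l₁ (vertex W₁) (vertex W₂) (trans (end W₁) (sym (start W₂)))
    start′ : vertex′ 0 ≡ u
    start′ = trans (before z≤n) (start W₁)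
    end′ : vertex′ (l₁ + length W₂) ≡ w
    end′ = trans (after (length W₂)) (end W₂)
    steps′ : ∀ t → t < l₁ + length W₂ → O (vertex′ t) (vertex′ (suc t)) ≡ true
    steps′ t t<l = [ earlier , later ]′ (ℕ.<-≤-connex t l₁)
      where
      earlier : t < l₁ → O (vertex′ t) (vertex′ (suc t)) ≡ true
      earlier t<l₁ = subst₂ (λ a b → O a b ≡ true) (sym (before (ℕ.<⇒≤ t<l₁))) (sym (before t<l₁)) (steps W₁ t t<l₁)
      later : l₁ ≤ t → O (vertex′ t) (vertex′ (suc t)) ≡ true
      later l₁≤t = subst₂ (λ a b → O a b ≡ true) (sym (trans (cong vertex′ t≡l₁+s) (after s)))
        (sym (trans (cong vertex′ (trans (cong suc t≡l₁+s) (sym (ℕ.+-suc l₁ s)))) (after (suc s))))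
        (steps W₂ s (ℕ.+-cancelˡ-< l₁ _ _ (subst (_< l₁ + length W₂) t≡l₁+s t<l)))
        where
        s : ℕ
        s = t ∸ l₁
        t≡l₁+s : t ≡ l₁ + s
        t≡l₁+s = sym (ℕ.m+[n∸m]≡n l₁≤t)

  ◅◅-vertexˡ : ∀ {u v w} (W₁ : Walk u v) (W₂ : Walk v w) {t} → t ≤ length W₁ → vertex (W₁ ◅◅ W₂) t ≡ vertex W₁ t
  ◅◅-vertexˡ W₁ W₂ = splice-≤ (length W₁) (vertex W₁) (vertex W₂)

  ◅◅-vertexʳ : ∀ {u v w} (W₁ : Walk u v) (W₂ : Walk v w) s → vertex (W₁ ◅◅ W₂) (length W₁ + s) ≡ vertex W₂ s
  ◅◅-vertexʳ W₁ W₂ = splice-+ (length W₁) (vertex W₁) (vertex W₂) (trans (end W₁) (sym (start W₂)))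

  segment : ∀ {u v} (W : Walk u v) {a b} → a ≤ b → b ≤ length W → Walk (vertex W a) (vertex W b)
  segment W {a} {b} a≤b b≤l = walk (b ∸ a) (λ s → vertex W (a + s)) (cong (vertex W) (ℕ.+-identityʳ a))
    (cong (vertex W) (ℕ.m+[n∸m]≡n a≤b)) steps′
    where
    steps′ : ∀ s → s < b ∸ a → O (vertex W (a + s)) (vertex W (a + suc s)) ≡ true
    steps′ s s<b∸a = subst (λ t → O (vertex W (a + s)) (vertex W t) ≡ true) (sym (ℕ.+-suc a s))
      (steps W (a + s) (ℕ.<-≤-trans (ℕ.+-monoʳ-< a s<b∸a) (subst (_≤ length W) (sym (ℕ.m+[n∸m]≡n a≤b)) b≤l)))

  pathOf : ∀ {u v} (W : Walk u v) → Fin (suc (length W)) → Fin n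
  pathOf W i = vertex W (toℕ i)

  toDirPath : ∀ {u v} (W : Walk u v) → DirPath O (length W) (pathOf W)
  toDirPath W i = subst (λ t → O (vertex W t) (vertex W (suc (toℕ i))) ≡ true) (sym (toℕ-inject₁ i))
    (steps W (toℕ i) (toℕ<n i))

  walk-length-pos : ∀ {u v} (W : Walk u v) → u ≢ v → 0 < length W
  walk-length-pos (walk zero    g s e _) u≢v = contradiction (trans (sym s) e) u≢v
  walk-length-pos (walk (suc _) _ _ _ _) _   = s≤s z≤n

  reaches≤ : ℕ → Fin n → Fin n → Bool
  reachesVia? : ∀ k u v → Dec (∃ λ a → O u a ∧ reaches≤ k a v ≡ true)

  reaches≤ zero    u v = does (u ≟ v)
  reaches≤ (suc k) u v = does (u ≟ v) ∨ does (reachesVia? k u v)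

  reachesVia? k u v = any? λ a → O u a ∧ reaches≤ k a v Bool.≟ true

  reaches≤-refl : ∀ k u → reaches≤ k u u ≡ true
  reaches≤-refl zero    u = dec-true (u ≟ u) refl
  reaches≤-refl (suc k) u rewrite dec-true (u ≟ u) refl = refl

  reaches≤⇒walk : ∀ k {u v} → reaches≤ k u v ≡ true → Walk u v
  reaches≤⇒walk zero    {u} {v} e = subst (Walk u) (does⇒ (u ≟ v) e) ε
  reaches≤⇒walk (suc k) {u} {v} e with ∨-elim (does (u ≟ v)) e
  ... | inj₁ u≡v = subst (Walk u) (does⇒ (u ≟ v) u≡v) ε
  ... | inj₂ step with does⇒ (reachesVia? k u v) step
  ... | a , ua∧av = ∧-elimˡ ua∧av ◅ reaches≤⇒walk k (∧-elimʳ ua∧av)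

  steps⇒reaches≤ : ∀ k l (g : ℕ → Fin n) → (∀ t → t < l → O (g t) (g (suc t)) ≡ true) → l ≤ k →
    reaches≤ k (g 0) (g l) ≡ true
  steps⇒reaches≤ k       zero    g _  _         = reaches≤-refl k (g 0)
  steps⇒reaches≤ (suc k) (suc l) g st (s≤s l≤k) = ∨-introʳ (does (g 0 ≟ g (suc l)))
    (dec-true (reachesVia? k (g 0) (g (suc l))) (g 1 , ∧-intro (st 0 (s≤s z≤n))
      (steps⇒reaches≤ k l (λ t → g (suc t)) (λ t t<l → st (suc t) (s≤s t<l)) l≤k)))

  -- In an acyclic orientation every walk is shorter than n (walk-length<), so the bound loses nothing.
  reaches : Fin n → Fin n → Bool
  reaches = reaches≤ n

  module _ (acyclic : Acyclic O) where

    walk-acyclic : ∀ {u v} (W : Walk u v) → ¬ (O v u ≡ true)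
    walk-acyclic W vu = acyclic (length W) (pathOf W) (toDirPath W)
      (subst₂ (λ a b → O a b ≡ true) (sym (trans (cong (vertex W) (toℕ-fromℕ (length W))) (end W)))
                                     (sym (start W)) vu)

    no-closed-walk : ∀ {u v} (W : Walk u v) → u ≡ v → 0 < length W → ⊥
    no-closed-walk (walk (suc k) g s e st) refl _ =
      walk-acyclic (walk k g s refl λ t t<k → st t (ℕ.m≤n⇒m≤1+n t<k))
                   (subst (λ b → O (g k) b ≡ true) e (st k ℕ.≤-refl))

    -- Pigeonhole: a longer walk repeats a vertex, and the segment between the repetitions is closed.
    walk-length< : ∀ {u v} (W : Walk u v) → length W < n
    walk-length< W with length W ℕ.<? n
    ... | yes l<n = l<n
    ... | no  l≮n with pigeonhole (s≤s (ℕ.≮⇒≥ l≮n)) (λ i → vertex W (toℕ i))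
    ... | i , j , i<j , same =
      ⊥-elim (no-closed-walk (segment W (ℕ.<⇒≤ i<j) (ℕ.s≤s⁻¹ (toℕ<n j))) same (ℕ.m<n⇒0<n∸m i<j))

    reaches⇒walk : ∀ {u v} → reaches u v ≡ true → Walk u v
    reaches⇒walk = reaches≤⇒walk n

    walk⇒reaches : ∀ {u v} → Walk u v → reaches u v ≡ true
    walk⇒reaches W = subst₂ (λ a b → reaches a b ≡ true) (start W) (end W)
      (steps⇒reaches≤ n (length W) (vertex W) (steps W) (ℕ.<⇒≤ (walk-length< W)))

    reaches-refl : ∀ u → reaches u u ≡ true
    reaches-refl = reaches≤-refl n

    reaches-trans : ∀ {a b c} → reaches a b ≡ true → reaches b c ≡ true → reaches a c ≡ true
    reaches-trans ab bc = walk⇒reaches (reaches⇒walk ab ◅◅ reaches⇒walk bc)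

    arc⇒reaches : ∀ {a b} → O a b ≡ true → reaches a b ≡ true
    arc⇒reaches ab = walk⇒reaches (ab ◅ ε)

    reaches-antisym : ∀ {u v} → reaches u v ≡ true → reaches v u ≡ true → u ≡ v
    reaches-antisym {u} {v} uv vu with u ≟ v
    ... | yes u≡v = u≡v
    ... | no  u≢v = ⊥-elim (no-closed-walk (W ◅◅ reaches⇒walk vu) refl
                      (ℕ.≤-trans (walk-length-pos W u≢v) (ℕ.m≤m+n (length W) _)))
      where
      W : Walk u v
      W = reaches⇒walk uv

    module _ (semi : SemiTransitiveCond O) where

      walk-chord : ∀ {u v} (W : Walk u v) → O u v ≡ true → ∀ {s t} → s < t → t ≤ length W →
        O (vertex W s) (vertex W t) ≡ true
      walk-chord W uv {s} {t} s<t t≤l = [ contradiction shortcut , chord ]′ (semi (length W) (pathOf W) (toDirPath W))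
        where
        shortcut : O (vertex W (toℕ {suc (length W)} zero)) (vertex W (toℕ (fromℕ (length W)))) ≡ true
        shortcut = subst₂ (λ a b → O a b ≡ true) (sym (start W))
          (sym (trans (cong (vertex W) (toℕ-fromℕ (length W))) (end W))) uv
        t<1+l : t < suc (length W)
        t<1+l = s≤s t≤l
        s<1+l : s < suc (length W)
        s<1+l = ℕ.<-trans s<t t<1+l
        chord : (∀ i j → i Fin.< j → O (pathOf W i) (pathOf W j) ≡ true) → O (vertex W s) (vertex W t) ≡ true
        chord closed = subst₂ (λ a b → O (vertex W a) (vertex W b) ≡ true) (toℕ-fromℕ< s<1+l) (toℕ-fromℕ< t<1+l)
          (closed (fromℕ< s<1+l) (fromℕ< t<1+l)
                  (subst₂ _<_ (sym (toℕ-fromℕ< s<1+l)) (sym (toℕ-fromℕ< t<1+l)) s<t))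

      -- a ⇝ u ⇝ v ⇝ b and a → b form one walk with a shortcut, whose chord u → v must be present.
      reaches-chord : ∀ {a u v b} → reaches a u ≡ true → reaches u v ≡ true → reaches v b ≡ true →
        O a b ≡ true → u ≢ v → O u v ≡ true
      reaches-chord {a} {u} {v} {b} au uv vb ab u≢v = subst₂ (λ a b → O a b ≡ true) at-u at-v
        (walk-chord W ab (ℕ.m<m+n l₁ (walk-length-pos W₂ u≢v)) (ℕ.m≤m+n (l₁ + length W₂) (length W₃)))
        where
        W₁ : Walk a u
        W₁ = reaches⇒walk au
        W₂ : Walk u v
        W₂ = reaches⇒walk uv
        W₃ : Walk v b
        W₃ = reaches⇒walk vb
        W : Walk a b
        W = (W₁ ◅◅ W₂) ◅◅ W₃
        l₁ : ℕ
        l₁ = length W₁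
        at-u : vertex W l₁ ≡ u
        at-u = trans (◅◅-vertexˡ (W₁ ◅◅ W₂) W₃ (ℕ.m≤m+n l₁ (length W₂)))
                     (trans (◅◅-vertexˡ W₁ W₂ ℕ.≤-refl) (end W₁))
        at-v : vertex W (l₁ + length W₂) ≡ v
        at-v = trans (◅◅-vertexˡ (W₁ ◅◅ W₂) W₃ ℕ.≤-refl)
                     (trans (◅◅-vertexʳ W₁ W₂ (length W₂)) (end W₂))

module TopologicalOrder {n : ℕ} (O : Fin n → Fin n → Bool) (acyclic : Acyclic O) where
  open Walks O

  ancestors : Fin n → Subset n
  ancestors v = Vec.tabulate λ a → reaches a v

  height : Fin n → ℕ
  height v = ∣ ancestors v ∣

  ∈-ancestors : ∀ {a v} → reaches a v ≡ true → a ∈ₛ ancestors v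
  ∈-ancestors {a} {v} av = lookup⇒[]= a (ancestors v) (trans (lookup∘tabulate _ a) av)

  ∈-ancestors⁻ : ∀ {a v} → a ∈ₛ ancestors v → reaches a v ≡ true
  ∈-ancestors⁻ {a} {v} a∈ = trans (sym (lookup∘tabulate _ a)) ([]=⇒lookup a∈)

  height-mono : ∀ {a b} → reaches a b ≡ true → a ≢ b → height a < height b
  height-mono {a} {b} ab a≢b = p⊂q⇒∣p∣<∣q∣
    ( (λ z∈ → ∈-ancestors (reaches-trans acyclic (∈-ancestors⁻ z∈) ab))
    , b , ∈-ancestors (reaches-refl acyclic b) , λ b∈ → a≢b (reaches-antisym acyclic ab (∈-ancestors⁻ b∈)))

  level : ℕ → List (Fin n)
  level s = filter (λ v → height v ℕ.≟ s) (allFin n)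

  levels : ℕ → ℕ → List (Fin n)
  levels s zero    = []
  levels s (suc k) = level s ++ levels (suc s) k

  occ-level : ∀ v s → height v ≡ s → occ v (level s) ≡ 1
  occ-level v s h≡s = trans (occ-filter (λ v → height v ℕ.≟ s) (allFin n) h≡s) (occ-allFin v)

  occ-level-reject : ∀ v s → height v ≢ s → occ v (level s) ≡ 0
  occ-level-reject v s = occ-filter-reject (λ v → height v ℕ.≟ s) (allFin n)

  occ-levels-below : ∀ v s k → height v < s → occ v (levels s k) ≡ 0
  occ-levels-below v s zero    _   = refl
  occ-levels-below v s (suc k) h<s = trans (occ-++ v (level s) _)
    (cong₂ _+_ (occ-level-reject v s (ℕ.<⇒≢ h<s)) (occ-levels-below v (suc s) k (ℕ.m≤n⇒m≤1+n h<s)))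

  occ-levels-above : ∀ v s k → s + k ≤ height v → occ v (levels s k) ≡ 0
  occ-levels-above v s zero    _     = refl
  occ-levels-above v s (suc k) s+k≤h = trans (occ-++ v (level s) _)
    (cong₂ _+_ (occ-level-reject v s (≢-sym (ℕ.<⇒≢ (ℕ.<-≤-trans (ℕ.m<m+n s (s≤s z≤n)) s+k≤h))))
               (occ-levels-above v (suc s) k (subst (_≤ height v) (ℕ.+-suc s k) s+k≤h)))

  occ-levels-within : ∀ v s k → s ≤ height v → height v < s + k → occ v (levels s k) ≡ 1
  occ-levels-within v s zero    s≤h h<s+0 = contradiction (subst (height v <_) (ℕ.+-identityʳ s) h<s+0) (ℕ.≤⇒≯ s≤h)
  occ-levels-within v s (suc k) s≤h h<s+k with height v ℕ.≟ s
  ... | yes h≡s = trans (occ-++ v (level s) _)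
    (cong₂ _+_ (occ-level v s h≡s) (occ-levels-below v (suc s) k (s≤s (ℕ.≤-reflexive h≡s))))
  ... | no  h≢s = trans (occ-++ v (level s) _)
    (cong₂ _+_ (occ-level-reject v s h≢s)
               (occ-levels-within v (suc s) k (ℕ.≤∧≢⇒< s≤h (≢-sym h≢s)) (subst (height v <_) (ℕ.+-suc s k) h<s+k)))

  levels-+ : ∀ s k l → levels s (k + l) ≡ levels s k ++ levels (s + k) l
  levels-+ s zero    l = cong (λ t → levels t l) (sym (ℕ.+-identityʳ s))
  levels-+ s (suc k) l = begin
    level s ++ levels (suc s) (k + l)                  ≡⟨ cong (level s ++_) (levels-+ (suc s) k l) ⟩
    level s ++ (levels (suc s) k ++ levels (suc s + k) l)
      ≡⟨ cong (λ t → level s ++ (levels (suc s) k ++ levels t l)) (sym (ℕ.+-suc s k)) ⟩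
    level s ++ (levels (suc s) k ++ levels (s + suc k) l) ≡⟨ sym (++-assoc (level s) _ _) ⟩
    levels s (suc k) ++ levels (s + suc k) l            ∎
    where open ≡-Reasoning

  topSort : List (Fin n)
  topSort = levels 0 (suc n)

  height≤n : ∀ v → height v ≤ n
  height≤n v = ∣p∣≤n (ancestors v)

  occ-topSort : ∀ v → occ v topSort ≡ 1
  occ-topSort v = occ-levels-within v 0 (suc n) z≤n (s≤s (height≤n v))

  ∈-topSort : ∀ v → v ∈ topSort
  ∈-topSort v = occ≡1⇒∈ topSort (occ-topSort v)

  restrict-topSort : ∀ u v → height u < height v → restrict u v topSort ≡ u ∷ v ∷ []
  restrict-topSort u v hu<hv = begin
    restrict u v topSort                     ≡⟨ cong (restrict u v) split ⟩
    restrict u v (lower ++ upper)            ≡⟨ restrict-++ u v lower upper ⟩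
    restrict u v lower ++ restrict u v upper ≡⟨ cong₂ _++_ lower-u upper-v ⟩
    u ∷ v ∷ []                               ∎
    where
    open ≡-Reasoning
    k : ℕ
    k = suc (height u)
    lower upper : List (Fin n)
    lower = levels 0 k
    upper = levels k (n ∸ height u)
    split : topSort ≡ lower ++ upper
    split = trans (cong (levels 0) (sym (cong suc (ℕ.m+[n∸m]≡n (height≤n u))))) (levels-+ 0 k (n ∸ height u))
    lower-u : restrict u v lower ≡ u ∷ []
    lower-u = restrict-single u v lower (occ-levels-within u 0 k z≤n ℕ.≤-refl) (occ-levels-above v 0 k hu<hv)
    upper-v : restrict u v upper ≡ v ∷ []
    upper-v = trans (restrict-comm u v upper) (restrict-single v u upper
      (occ-levels-within v k (n ∸ height u) hu<hv
        (subst (height v <_) (sym (cong suc (ℕ.m+[n∸m]≡n (height≤n u)))) (s≤s (height≤n v))))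
      (occ-levels-below u k (n ∸ height u) ℕ.≤-refl))

  arc⇒restrict-topSort : ∀ {u v} → O u v ≡ true → restrict u v topSort ≡ u ∷ v ∷ []
  arc⇒restrict-topSort {u} {v} uv =
    restrict-topSort u v (height-mono (arc⇒reaches acyclic uv) λ { refl → acyclic 0 (λ _ → u) (λ ()) uv })

  restrict-topSort-either : ∀ u v → u ≢ v → restrict u v topSort ≡ u ∷ v ∷ [] ⊎ restrict u v topSort ≡ v ∷ u ∷ []
  restrict-topSort-either u v u≢v = restrict-pair u v topSort u≢v (occ-topSort u) (occ-topSort v)

-- Semi-transitive graphs are word-representable

indicator : Bool → ℕ
indicator true  = 1
indicator false = 0

indicator≤1 : ∀ x → indicator x ≤ 1
indicator≤1 true  = ℕ.≤-refl
indicator≤1 false = z≤n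

-- Omitting a from copy i and b from copy j of a wave keeps them alternating (Block.block-alternates).
SkipCompatible : ℕ → ℕ → Set
SkipCompatible i j = j ≡ i ⊎ suc j ≡ i

compatible-plain : ∀ x₁ x₂ → (x₁ ≡ true → x₂ ≡ true) →
  SkipCompatible (indicator (not x₁)) (indicator (not x₂))
compatible-plain true  true  _     = inj₁ refl
compatible-plain true  false x₁⇒x₂ = contradiction (x₁⇒x₂ refl) λ ()
compatible-plain false true  _     = inj₂ refl
compatible-plain false false _     = inj₁ refl

compatible-obstruction : ∀ x₁ x₂ y₁ y₂ → (x₂ ≡ true → x₁ ≡ true) → (y₁ ≡ true → y₂ ≡ true) →
  (x₁ ≡ true → y₂ ≡ true → ⊥) →
  SkipCompatible (indicator x₁ + indicator (not y₁)) (indicator x₂ + indicator (not y₂))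
compatible-obstruction true  _     _     true  _     _     ¬x₁y₂ = ⊥-elim (¬x₁y₂ refl refl)
compatible-obstruction true  _     true  false _     y₁⇒y₂ _     = contradiction (y₁⇒y₂ refl) λ ()
compatible-obstruction true  true  false false _     _     _     = inj₁ refl
compatible-obstruction true  false false false _     _     _     = inj₂ refl
compatible-obstruction false true  _     _     x₂⇒x₁ _     _     = contradiction (x₂⇒x₁ refl) λ ()
compatible-obstruction false false true  true  _     _     _     = inj₁ refl
compatible-obstruction false false true  false _     y₁⇒y₂ _     = contradiction (y₁⇒y₂ refl) λ ()
compatible-obstruction false false false true  _     _     _     = inj₂ refl
compatible-obstruction false false false false _     _     _     = inj₁ refl

-- A wave is a linear order followed by three copies of it, each vertex being omitted from one
-- copy.  If a comes before b in the order, a is omitted from copy i and b from copy j, then the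
-- restriction of the wave to {a, b} is a ∷ block i j.
module Block {n : ℕ} (a b : Fin n) where

  copy : ℕ → ℕ → ℕ → List (Fin n)
  copy i j c = (if i ℕ.≡ᵇ c then [] else a ∷ []) ++ (if j ℕ.≡ᵇ c then [] else b ∷ [])

  block : ℕ → ℕ → List (Fin n)
  block i j = b ∷ copy i j 0 ++ copy i j 1 ++ copy i j 2

  filter-pair : ∀ (s : Fin n → ℕ) c → filter (λ z → ¬? (s z ℕ.≟ c)) (a ∷ b ∷ []) ≡ copy (s a) (s b) c
  filter-pair s c with s a ℕ.≡ᵇ c
  ... | true  with s b ℕ.≡ᵇ c
  ...   | true  = refl
  ...   | false = refl
  filter-pair s c | false with s b ℕ.≡ᵇ c
  ...   | true  = refl
  ...   | false = refl

  block-alternates : a ≢ b → ∀ i j → i ≤ 2 → j ≤ 2 → NoSquareFactor (a ∷ block i j ++ a ∷ []) ⇔ SkipCompatible i j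
  block-alternates a≢b i j i≤2 j≤2 = mk⇔ (from-alternating i j i≤2 j≤2) (to-alternating i j i≤2 j≤2)
    where
    b≢a : b ≢ a
    b≢a = ≢-sym a≢b
    abababa : NoSquareFactor (a ∷ b ∷ a ∷ b ∷ a ∷ b ∷ a ∷ [])
    abababa = a≢b , b≢a , a≢b , b≢a , a≢b , b≢a , tt
    to-alternating : ∀ i j → i ≤ 2 → j ≤ 2 → SkipCompatible i j → NoSquareFactor (a ∷ block i j ++ a ∷ [])
    to-alternating 0 0 _ _ _ = abababa
    to-alternating 1 1 _ _ _ = abababa
    to-alternating 2 2 _ _ _ = abababa
    to-alternating 1 0 _ _ _ = abababa
    to-alternating 2 1 _ _ _ = abababa
    to-alternating 0 (suc _) _ _ (inj₁ ())
    to-alternating 0 (suc _) _ _ (inj₂ ())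
    to-alternating 1 (suc (suc _)) _ _ (inj₁ ())
    to-alternating 1 (suc (suc _)) _ _ (inj₂ ())
    to-alternating 2 0 _ _ (inj₁ ())
    to-alternating 2 0 _ _ (inj₂ ())
    to-alternating (suc (suc (suc _))) _ (s≤s (s≤s ())) _ _
    to-alternating _ (suc (suc (suc _))) _ (s≤s (s≤s ())) _
    from-alternating : ∀ i j → i ≤ 2 → j ≤ 2 → NoSquareFactor (a ∷ block i j ++ a ∷ []) → SkipCompatible i j
    from-alternating 0 0 _ _ _ = inj₁ refl
    from-alternating 1 1 _ _ _ = inj₁ refl
    from-alternating 2 2 _ _ _ = inj₁ refl
    from-alternating 1 0 _ _ _ = inj₂ refl
    from-alternating 2 1 _ _ _ = inj₂ refl
    from-alternating 0 1 _ _ (_ , bb , _)         = contradiction refl bb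
    from-alternating 0 2 _ _ (_ , bb , _)         = contradiction refl bb
    from-alternating 1 2 _ _ (_ , _ , _ , bb , _) = contradiction refl bb
    from-alternating 2 0 _ _ (_ , _ , aa , _)     = contradiction refl aa
    from-alternating (suc (suc (suc _))) _ (s≤s (s≤s ())) _ _
    from-alternating _ (suc (suc (suc _))) _ (s≤s (s≤s ())) _

module WordFromOrientation {n : ℕ} (G : Graph n) (O : Fin n → Fin n → Bool)
  (orientation : IsOrientation G O) (acyclic : Acyclic O) (semi : SemiTransitiveCond O) where
  open Walks O
  open TopologicalOrder O acyclic
  open Orientation {G = G} {O = O} orientation

  obstruction : Fin n → Fin n → Bool
  obstruction u v = reaches u v ∧ not (Adj G u v) ∧ not (does (u ≟ v))

  -- The copy of the wave of (u , v) that omits z.  Along an arc a → b the skips of a and b are compatible,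
  -- the case a ⇝ u, v ⇝ b being excluded by semi-transitivity, while for a non-adjacent pair (a , b)
  -- the wave of (a , b) itself breaks the alternation of a and b.
  skip : Fin n × Fin n → Fin n → ℕ
  skip (u , v) z = if obstruction u v
    then indicator (reaches z u) + indicator (not (reaches v z))
    else indicator (not (reaches u z))

  skip≤2 : ∀ q z → skip q z ≤ 2
  skip≤2 (u , v) z with obstruction u v
  ... | true  = ℕ.+-mono-≤ (indicator≤1 (reaches z u)) (indicator≤1 (not (reaches v z)))
  ... | false = ℕ.m≤n⇒m≤1+n (indicator≤1 (not (reaches u z)))

  omit : Fin n × Fin n → ℕ → List (Fin n)
  omit q c = filter (λ z → ¬? (skip q z ℕ.≟ c)) topSort

  wave : Fin n × Fin n → List (Fin n)
  wave q = topSort ++ omit q 0 ++ omit q 1 ++ omit q 2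

  pairs : List (Fin n × Fin n)
  pairs = cartesianProduct (allFin n) (allFin n)

  word : List (Fin n)
  word = concatMap wave pairs ++ topSort

  obstruction⇒ : ∀ {u v} → obstruction u v ≡ true → reaches u v ≡ true × Adj G u v ≡ false × u ≢ v
  obstruction⇒ {u} {v} obs with reaches u v | Adj G u v | u ≟ v
  ... | true | false | no u≢v = refl , refl , u≢v

  arc⇒compatible : ∀ {a b} → O a b ≡ true → ∀ q → SkipCompatible (skip q a) (skip q b)
  arc⇒compatible {a} {b} ab (u , v) with obstruction u v in obs
  ... | true  with obstruction⇒ obs
  ...   | uv , ¬uv , u≢v = compatible-obstruction (reaches a u) (reaches b u) (reaches v a) (reaches v b)
    (reaches-trans acyclic (arc⇒reaches acyclic ab)) (λ va → reaches-trans acyclic va (arc⇒reaches acyclic ab))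
    λ au vb → true≢false (trans (sym (arc⇒edge u v (reaches-chord acyclic semi au uv vb ab u≢v))) ¬uv)
  arc⇒compatible {a} {b} ab (u , v) | false =
    compatible-plain (reaches u a) (reaches u b) (λ ua → reaches-trans acyclic ua (arc⇒reaches acyclic ab))

  skip-obstruction : ∀ {u v} z → obstruction u v ≡ true →
    skip (u , v) z ≡ indicator (reaches z u) + indicator (not (reaches v z))
  skip-obstruction z obs rewrite obs = refl

  skip-plain : ∀ {u v} z → obstruction u v ≡ false → skip (u , v) z ≡ indicator (not (reaches u z))
  skip-plain z obs rewrite obs = refl

  nonadjacent⇒incompatible : ∀ {a b} → a ≢ b → Adj G a b ≡ false → ¬ SkipCompatible (skip (a , b) a) (skip (a , b) b)
  nonadjacent⇒incompatible {a} {b} a≢b ¬ab = by-reachability (reaches a b) refl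
    where
    by-reachability : ∀ r → reaches a b ≡ r → ¬ SkipCompatible (skip (a , b) a) (skip (a , b) b)
    by-reachability true ab compatible with subst₂ SkipCompatible skip-a skip-b compatible
      where
      obs : obstruction a b ≡ true
      obs rewrite ab | ¬ab | dec-false (a ≟ b) a≢b = refl
      ba : reaches b a ≡ false
      ba with reaches b a in ba
      ... | true  = contradiction (reaches-antisym acyclic ab ba) a≢b
      ... | false = refl
      skip-a : skip (a , b) a ≡ 2
      skip-a = trans (skip-obstruction a obs)
        (cong₂ _+_ (cong indicator (reaches-refl acyclic a)) (cong (λ r → indicator (not r)) ba))
      skip-b : skip (a , b) b ≡ 0
      skip-b = trans (skip-obstruction b obs)
        (cong₂ _+_ (cong indicator ba) (cong (λ r → indicator (not r)) (reaches-refl acyclic b)))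
    ... | inj₁ ()
    ... | inj₂ ()
    by-reachability false ab compatible with subst₂ SkipCompatible skip-a skip-b compatible
      where
      obs : obstruction a b ≡ false
      obs rewrite ab = refl
      skip-a : skip (a , b) a ≡ 0
      skip-a = trans (skip-plain a obs) (cong (λ r → indicator (not r)) (reaches-refl acyclic a))
      skip-b : skip (a , b) b ≡ 1
      skip-b = trans (skip-plain b obs) (cong (λ r → indicator (not r)) ab)
    ... | inj₁ ()
    ... | inj₂ ()

  module _ {a b : Fin n} (a≢b : a ≢ b) (a<b : restrict a b topSort ≡ a ∷ b ∷ []) where
    open Block a b

    restrict-wave : ∀ q → restrict a b (wave q) ≡ a ∷ block (skip q a) (skip q b)
    restrict-wave q = begin
      restrict a b (topSort ++ omit q 0 ++ omit q 1 ++ omit q 2)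
        ≡⟨ restrict-++ a b topSort _ ⟩
      restrict a b topSort ++ restrict a b (omit q 0 ++ omit q 1 ++ omit q 2)
        ≡⟨ cong₂ _++_ a<b (trans (restrict-++ a b (omit q 0) _) (cong₂ _++_ (restrict-omit 0)
             (trans (restrict-++ a b (omit q 1) _) (cong₂ _++_ (restrict-omit 1) (restrict-omit 2))))) ⟩
      a ∷ block (skip q a) (skip q b) ∎
      where
      open ≡-Reasoning
      restrict-omit : ∀ c → restrict a b (omit q c) ≡ copy (skip q a) (skip q b) c
      restrict-omit c = trans (restrict-filter a b _ topSort) (trans (cong (filter _) a<b) (filter-pair (skip q) c))

    restrict-word : restrict a b word ≡ blocks a (λ q → block (skip q a) (skip q b)) pairs ++ a ∷ b ∷ []
    restrict-word = trans (restrict-++ a b (concatMap wave pairs) topSort)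
      (cong₂ _++_ (trans (restrict-concatMap a b wave pairs) (concatMap-cong restrict-wave pairs)) a<b)

    alternate⇔compatible : Alternate a b word ⇔ (∀ q → SkipCompatible (skip q a) (skip q b))
    alternate⇔compatible = mk⇔ to from
      where
      each-block : ∀ q → NoSquareFactor (a ∷ block (skip q a) (skip q b) ++ a ∷ []) ⇔ SkipCompatible (skip q a) (skip q b)
      each-block q = block-alternates a≢b (skip q a) (skip q b) (skip≤2 q a) (skip≤2 q b)
      blocks-alternate : NoSquareFactor (blocks a (λ q → block (skip q a) (skip q b)) pairs ++ a ∷ b ∷ []) ⇔
        (All (λ q → NoSquareFactor (a ∷ block (skip q a) (skip q b) ++ a ∷ [])) pairs × NoSquareFactor (a ∷ b ∷ []))
      blocks-alternate = noSquareFactor-blocks a (λ q → block (skip q a) (skip q b)) pairs (b ∷ [])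
      to : Alternate a b word → ∀ q → SkipCompatible (skip q a) (skip q b)
      to alt (u , v) = Equivalence.to (each-block (u , v))
        (All.lookup (proj₁ (Equivalence.to blocks-alternate (subst NoSquareFactor restrict-word alt)))
                    (∈-cartesianProduct⁺ (∈-allFin u) (∈-allFin v)))
      from : (∀ q → SkipCompatible (skip q a) (skip q b)) → Alternate a b word
      from compatible = subst NoSquareFactor (sym restrict-word) (Equivalence.from blocks-alternate
        (All.tabulate (λ {q} _ → Equivalence.from (each-block q) (compatible q)) , a≢b , tt))

    edge⇒arc : Edge G a b → O a b ≡ true
    edge⇒arc e = [ (λ ab → ab) , (λ ba → contradiction (∷-injectiveˡ (trans (sym (arc⇒restrict-topSort ba))
                                                         (trans (restrict-comm b a topSort) a<b))) (≢-sym a≢b)) ]′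
      (total a b e)

    represents-ordered : Edge G a b ⇔ Alternate a b word
    represents-ordered = mk⇔ (λ e → Equivalence.from alternate⇔compatible (arc⇒compatible (edge⇒arc e))) from
      where
      from : Alternate a b word → Edge G a b
      from alt with Adj G a b in ab
      ... | true  = refl
      ... | false = ⊥-elim (nonadjacent⇒incompatible a≢b ab (Equivalence.to alternate⇔compatible alt (a , b)))

  represents : ∀ a b → a ≢ b → Edge G a b ⇔ Alternate a b word
  represents a b a≢b with restrict-topSort-either a b a≢b
  ... | inj₁ a<b = represents-ordered a≢b a<b
  ... | inj₂ b<a = mk⇔
    (λ e → alternate-comm word (Equivalence.to ba (trans (Graph.sym G b a) e)))
    (λ alt → trans (Graph.sym G a b) (Equivalence.from ba (alternate-comm word alt)))
    where
    ba : Edge G b a ⇔ Alternate b a word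
    ba = represents-ordered (≢-sym a≢b) (trans (restrict-comm b a topSort) b<a)

  wordRepresentable : WordRepresentable G
  wordRepresentable = word , (λ v → ∈-++⁺ʳ (concatMap wave pairs) (∈-topSort v)) , represents

semiTransitive⇒wordRepresentable : ∀ {n} {G : Graph n} → SemiTransitive G → WordRepresentable G
semiTransitive⇒wordRepresentable {G = G} (O , orientation , acyclic , semi) =
  WordFromOrientation.wordRepresentable G O orientation acyclic semi

wordRepresentable⇔semiTransitive : ∀ {n} {G : Graph n} → WordRepresentable G ⇔ SemiTransitive G
wordRepresentable⇔semiTransitive {G = G} =
  mk⇔ (wordRepresentable⇒semiTransitive {G = G}) (semiTransitive⇒wordRepresentable {G = G})

-- Induced subgraphs and minimality

module _ {k n : ℕ} {G : Graph n} where

  semiTransitive-induced : ∀ (f : Fin k → Fin n) → SemiTransitive G → SemiTransitive (induced G f)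
  semiTransitive-induced f (O , (arc⇒edge , total , asym) , acyclic , semi) =
    (λ a b → O (f a) (f b)) ,
    ((λ a b → arc⇒edge (f a) (f b)) , (λ a b → total (f a) (f b)) , (λ a b → asym (f a) (f b))) ,
    (λ k p → acyclic k (λ i → f (p i))) , (λ k p → semi k (λ i → f (p i)))

  module _ {f g : Fin k → Fin n} (f≗g : ∀ i → f i ≡ g i) where

    private
      same-edges : ∀ a b → Edge (induced G f) a b → Edge (induced G g) a b
      same-edges a b = subst (_≡ true) (cong₂ (Adj G) (f≗g a) (f≗g b))

      same-edges⁻ : ∀ a b → Edge (induced G g) a b → Edge (induced G f) a b
      same-edges⁻ a b = subst (_≡ true) (sym (cong₂ (Adj G) (f≗g a) (f≗g b)))

      orientation-cong : ∀ {O} → IsOrientation (induced G f) O → IsOrientation (induced G g) O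
      orientation-cong (arc⇒edge , total , asym) =
        (λ a b ab → same-edges a b (arc⇒edge a b ab)) , (λ a b e → total a b (same-edges⁻ a b e)) , asym

    comparability-induced-cong : Comparability (induced G f) → Comparability (induced G g)
    comparability-induced-cong (O , orientation , transitive) = O , orientation-cong orientation , transitive

    semiTransitive-induced-cong : SemiTransitive (induced G f) → SemiTransitive (induced G g)
    semiTransitive-induced-cong (O , orientation , acyclic , semi) = O , orientation-cong orientation , acyclic , semi

_◂_ : ∀ {k m} → Fin (suc m) → (Fin k → Fin m) → Fin (suc k) → Fin (suc m)
(x ◂ f) zero    = x
(x ◂ f) (suc i) = punchIn x (f i)

◂-injective : ∀ {k m} (x : Fin (suc m)) {f : Fin k → Fin m} →
  Injective _≡_ _≡_ f → Injective _≡_ _≡_ (x ◂ f)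
◂-injective x inj {zero}  {zero}  _ = refl
◂-injective x inj {zero}  {suc j} e = contradiction (sym e) (punchInᵢ≢i x _)
◂-injective x inj {suc i} {zero}  e = contradiction e (punchInᵢ≢i x _)
◂-injective x inj {suc i} {suc j} e = cong suc (inj (punchIn-injective x _ _ e))

module _ {k m : ℕ} (x : Fin (suc m)) (g : Fin k → Fin (suc m)) (avoids : ∀ i → g i ≢ x) where

  squeeze : Fin k → Fin m
  squeeze i = punchOut (≢-sym (avoids i))

  punchIn-squeeze : ∀ i → punchIn x (squeeze i) ≡ g i
  punchIn-squeeze i = punchIn-punchOut (≢-sym (avoids i))

  squeeze-injective : Injective _≡_ _≡_ g → Injective _≡_ _≡_ squeeze
  squeeze-injective inj {i} {j} e =
    inj (trans (sym (punchIn-squeeze i)) (trans (cong (punchIn x) e) (punchIn-squeeze j)))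

EveryProperInduced : (∀ {k} → Graph k → Set) → ∀ {n} → Graph n → Set
EveryProperInduced P {n} G = ∀ k (f : Fin k → Fin n) → Injective _≡_ _≡_ f → k < n → P (induced G f)

module MinimalityTransfer {m : ℕ} (G : Graph (suc m)) (x : Fin (suc m))
  (universal : ∀ y → y ≢ x → Edge G x y) where
  open UniversalVertex G x universal using (H; semiTransitive⇔comparability)

  wordRepresentable⇔comparability : WordRepresentable G ⇔ Comparability H
  wordRepresentable⇔comparability = semiTransitive⇔comparability ⇔-∘ wordRepresentable⇔semiTransitive {G = G}

  everyProperInduced-comparability :
    EveryProperInduced WordRepresentable G → EveryProperInduced Comparability H
  everyProperInduced-comparability properG k f inj k<m =
    UniversalVertex.semiTransitive⇒comparability (induced G (x ◂ f)) zero apex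
      (wordRepresentable⇒semiTransitive {G = induced G (x ◂ f)}
        (properG (suc k) (x ◂ f) (◂-injective x inj) (s≤s k<m)))
    where
    apex : ∀ y → y ≢ zero → Edge (induced G (x ◂ f)) zero y
    apex zero    0≢0 = contradiction refl 0≢0
    apex (suc i) _   = universal (punchIn x (f i)) (punchInᵢ≢i x (f i))

  module _ (properH : EveryProperInduced Comparability H) (semiTransitiveH : SemiTransitive H) where

    wordRepresentable-through-x : ∀ {k} (g : Fin (suc k) → Fin (suc m)) → Injective _≡_ _≡_ g → k < m →
      ∀ j → g j ≡ x → WordRepresentable (induced G g)
    wordRepresentable-through-x g inj k<m j gj≡x = semiTransitive⇒wordRepresentable {G = induced G g}
      (Equivalence.from (UniversalVertex.semiTransitive⇔comparability (induced G g) j apex)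
        (comparability-induced-cong {G = G} (punchIn-squeeze x g∘punchIn avoids)
          (properH _ (squeeze x g∘punchIn avoids) (squeeze-injective x g∘punchIn avoids g∘punchIn-injective) k<m)))
      where
      g∘punchIn : Fin _ → Fin (suc m)
      g∘punchIn i = g (punchIn j i)
      g∘punchIn-injective : Injective _≡_ _≡_ g∘punchIn
      g∘punchIn-injective e = punchIn-injective j _ _ (inj e)
      avoids : ∀ i → g∘punchIn i ≢ x
      avoids i e = punchInᵢ≢i j i (inj (trans e (sym gj≡x)))
      apex : ∀ y → y ≢ j → Edge (induced G g) j y
      apex y y≢j = subst (λ z → Edge G z (g y)) (sym gj≡x)
        (universal (g y) (λ e → y≢j (inj (trans e (sym gj≡x)))))

    everyProperInduced-wordRepresentable : EveryProperInduced WordRepresentable G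
    everyProperInduced-wordRepresentable k g inj k<1+m with any? (λ j → g j ≟ x)
    everyProperInduced-wordRepresentable (suc k) g inj (s≤s k<m) | yes (j , gj≡x) =
      wordRepresentable-through-x g inj k<m j gj≡x
    everyProperInduced-wordRepresentable k g inj _ | no x∉g = semiTransitive⇒wordRepresentable {G = induced G g}
      (semiTransitive-induced-cong {G = G} (punchIn-squeeze x g avoids)
        (semiTransitive-induced {G = H} (squeeze x g avoids) semiTransitiveH))
      where
      avoids : ∀ i → g i ≢ x
      avoids i gi≡x = x∉g (i , gi≡x)

theorem9 : ∀ (m : ℕ) (G : Graph (suc m)) (x : Fin (suc m)) →
    (∀ y → y ≢ x → Edge G x y) →
    (MinimalNonWordRepresentable G ⇔
      (MinimalNonComparability (deleteVertex G x) × SemiTransitive (deleteVertex G x)))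
theorem9 m G x universal = mk⇔
  (λ (¬wrG , properG) →
     (¬wrG ∘ Equivalence.from wordRepresentable⇔comparability , everyProperInduced-comparability properG) ,
     wordRepresentable⇒semiTransitive {G = deleteVertex G x}
       (properG m (punchIn x) (punchIn-injective x _ _) (ℕ.n<1+n m)))
  (λ ((¬compH , properH) , semiTransitiveH) →
     ¬compH ∘ Equivalence.to wordRepresentable⇔comparability ,
     everyProperInduced-wordRepresentable properH semiTransitiveH)
  where open MinimalityTransfer G x universal
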